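{- Let $G$ be a finite abelian group of order $n$ and $H$ a finite abelian group of order $m$. Let $$\mathcal E_G=\{d\in\mathbb N : d\mid \gcd(n,m),\ \varphi_G(d)>\varphi_H(d)\},\qquad \mathcal E_H=\{d\in\mathbb N : d\mid \gcd(n,m),\ \varphi_G(d)<\varphi_H(d)\}.$$ If $\mathcal E_G$ is nonempty, then $\min\mathcal E_G$ is a prime power; likewise, if $\mathcal E_H$ is nonempty, then $\min\mathcal E_H$ is a prime power.
   Context: $\mathbb N$ denotes the set of positive integers. For a finite group $G$ and positive integer $d$, $\varphi_G(d)$ denotes the number of elements of $G$ of order exactly $d$. -}

module Defs where

open import Data.Nat using (ℕ; zero; suc; _<_; _≤_; _^_; _<?_)
open import Data.Nat.Primality using (Prime)
open import Data.Fin using (Fin; toℕ)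
open import Data.Fin.Properties using (_≟_; all?)
open import Data.List using (length; filter)
open import Data.List.Base using (allFin)
open import Data.Product using (Σ; _×_; ∃₂)
open import Relation.Binary.PropositionalEquality using (_≡_)
open import Relation.Nullary using (¬_; Dec; _×-dec_; ¬?)
open import Algebra.Structures using (IsAbelianGroup)

-- A finite abelian group of order n, presented (up to isomorphism) on the
-- carrier Fin n with propositional equality.
record FinAbGroup (n : ℕ) : Set where
  field
    _∙_ : Fin n → Fin n → Fin n
    ε : Fin n
    _⁻¹ : Fin n → Fin n
    isAbelianGroup : IsAbelianGroup _≡_ _∙_ ε _⁻¹

module _ {n : ℕ} (G : FinAbGroup n) where
  open FinAbGroup G

  pow : Fin n → ℕ → Fin n
  pow g zero = ε
  pow g (suc k) = g ∙ pow g k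

  HasOrder : Fin n → ℕ → Set
  HasOrder g d = (0 < d) × (pow g d ≡ ε) × (∀ (k : Fin d) → 0 < toℕ k → ¬ (pow g (toℕ k) ≡ ε))

  hasOrder? : (d : ℕ) → (g : Fin n) → Dec (HasOrder g d)
  hasOrder? d g = (0 <? d) ×-dec ((pow g d ≟ ε) ×-dec all? (λ k → ∀? k))
    where
    ∀? : (k : Fin d) → Dec (0 < toℕ k → ¬ (pow g (toℕ k) ≡ ε))
    ∀? k with 0 <? toℕ k | pow g (toℕ k) ≟ ε
    ... | Relation.Nullary.yes p | Relation.Nullary.yes q = Relation.Nullary.no (λ f → f p q)
    ... | Relation.Nullary.yes p | Relation.Nullary.no q = Relation.Nullary.yes (λ _ → q)
    ... | Relation.Nullary.no p | _ = Relation.Nullary.yes (λ z → Data.Empty.⊥-elim (p z))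
      where import Data.Empty

  φ : ℕ → ℕ
  φ d = length (filter (hasOrder? d) (allFin n))

IsPrimePower : ℕ → Set
IsPrimePower d = ∃₂ λ p k → Prime p × d ≡ p ^ suc k

module Submission where

-- The counting function φ_G is multiplicative: for coprime a and b, g ↦ (gᵇ, gᵃ) maps the
-- elements of order ab injectively to pairs of elements of orders a and b, and (x, y) ↦ xy
-- maps such pairs injectively back.  Now let d be least with φ_H(d) < φ_G(d).  d ≠ 1 since
-- φ_G(1) = φ_H(1) = 1, and if d = ab with coprime a, b > 1, minimality gives φ_G(a) ≤ φ_H(a)
-- and φ_G(b) ≤ φ_H(b), whence φ_G(d) ≤ φ_H(d).

open import Defs
open import Level using (0ℓ)
open import Data.Nat
  using (ℕ; zero; suc; _+_; _*_; _^_; _<_; _≤_; z<s; _%_; _/_; NonZero; >-nonZero; >-nonZero⁻¹; nonTrivial⇒n>1)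
open import Data.Nat.Properties
open import Data.Nat.DivMod using (m≡m%n+[m/n]*n; m%n<n)
open import Data.Nat.Divisibility
  using (_∣_; _∣?_; divides; ∣-trans; ∣⇒≤; m%n≡0⇒n∣m; m∣m*n; n∣m*n; 1∣_; *-cancelʳ-∣)
open import Data.Nat.Coprimality as Coprimality
  using (Coprime; coprime-Bézout; coprime-divisor; coprime⇒gcd≡1; 1-coprimeTo)
open import Data.Nat.GCD using (gcd; module Bézout)
open import Data.Nat.LCM using (lcm; lcm-least; gcd*lcm)
open import Data.Nat.Primality using (Prime; prime⇒irreducible; prime⇒nonZero; prime⇒nonTrivial; ¬prime[1])
open import Data.Nat.Primality.Factorisation using (factorise; PrimeFactorisation)
open import Data.Nat.ListAction using (product)
open import Data.Fin using (Fin; toℕ; fromℕ<; zero; suc)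
open import Data.Fin.Properties using (toℕ-fromℕ<; toℕ<n; injective⇒≤)
open import Data.List using (List; []; _∷_; length; lookup; map; filter; cartesianProduct)
open import Data.List.Base using (allFin)
open import Data.List.Properties using (length-++; length-map)
open import Data.List.Membership.Propositional using (_∈_)
open import Data.List.Membership.Propositional.Properties
  using (∈-lookup; ∈-filter⁺; ∈-filter⁻; ∈-allFin; ∈-cartesianProduct⁺; ∈-cartesianProduct⁻)
open import Data.List.Membership.Setoid.Properties using (index-injective)
open import Data.List.Relation.Unary.Any using (here; index)
open import Data.List.Relation.Unary.All as All using (All; []; _∷_)
open import Data.List.Relation.Unary.AllPairs using ([]; _∷_)
open import Data.List.Relation.Unary.Unique.Propositional using (Unique)
open import Data.List.Relation.Unary.Unique.Propositional.Properties using (allFin⁺; filter⁺; cartesianProduct⁺)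
open import Data.Product as Product using (_×_; _,_; proj₁; proj₂; uncurry)
open import Data.Sum using (inj₁; inj₂)
open import Function using (id; _∘_)
open import Relation.Nullary using (¬_; yes; no; contradiction)
open import Relation.Binary.PropositionalEquality
open import Algebra.Bundles using (AbelianGroup)
open import Algebra.Properties.CommutativeSemigroup *-commutativeSemigroup using (x∙yz≈y∙xz)

∣-coprime : ∀ {m n o} → m ∣ n → Coprime n o → Coprime m o
∣-coprime m∣n c (i∣m , i∣o) = c (∣-trans i∣m m∣n , i∣o)

coprime-*ˡ : ∀ {m n o} → Coprime m o → Coprime n o → Coprime (m * n) o
coprime-*ˡ cm cn (i∣mn , i∣o) =
  cn (coprime-divisor (∣-coprime i∣o (Coprimality.sym cm)) i∣mn , i∣o)

coprime-^ˡ : ∀ {m o} → Coprime m o → ∀ k → Coprime (m ^ k) o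
coprime-^ˡ {o = o} c zero    = 1-coprimeTo o
coprime-^ˡ         c (suc k) = coprime-*ˡ c (coprime-^ˡ c k)

prime∤⇒coprime : ∀ {p n} → Prime p → ¬ p ∣ n → Coprime p n
prime∤⇒coprime p-prime p∤n (i∣p , i∣n) with prime⇒irreducible p-prime i∣p
... | inj₁ i≡1  = i≡1
... | inj₂ refl = contradiction i∣n p∤n

prime∣prime⇒≡ : ∀ {p q} → Prime p → Prime q → p ∣ q → p ≡ q
prime∣prime⇒≡ p-prime q-prime p∣q with prime⇒irreducible q-prime p∣q
... | inj₁ refl = contradiction p-prime ¬prime[1]
... | inj₂ p≡q  = p≡q

prime>1 : ∀ {p} → Prime p → 1 < p
prime>1 {p} p-prime = nonTrivial⇒n>1 p {{prime⇒nonTrivial p-prime}}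

coprime⇒*∣ : ∀ {a b k} → Coprime a b → a ∣ k → b ∣ k → a * b ∣ k
coprime⇒*∣ {a} {b} {k} a⊥b a∣k b∣k = subst (_∣ k) lcm≡* (lcm-least a∣k b∣k)
  where
  lcm≡* : lcm a b ≡ a * b
  lcm≡* = trans (sym (*-identityˡ (lcm a b)))
    (trans (cong (_* lcm a b) (sym (coprime⇒gcd≡1 a⊥b))) (gcd*lcm a b))

data PrimePowerView : ℕ → Set where
  unit           : PrimePowerView 1
  primePower     : ∀ {d} → IsPrimePower d → PrimePowerView d
  coprimeProduct : ∀ {a b} → 1 < a → 1 < b → Coprime a b → PrimePowerView (a * b)

*-primePowerView : ∀ {p m} → Prime p → PrimePowerView m → PrimePowerView (p * m)
*-primePowerView {p} p-prime unit = primePower (p , 0 , p-prime , refl)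
*-primePowerView {p} p-prime (primePower (q , k , q-prime , refl)) with p ≟ q
... | yes refl = primePower (p , suc k , p-prime , refl)
... | no p≢q   = coprimeProduct (prime>1 p-prime) (^-monoʳ-< q (prime>1 q-prime) (z<s {k}))
  (Coprimality.sym (coprime-^ˡ q⊥p (suc k)))
  where
  q⊥p : Coprime q p
  q⊥p = prime∤⇒coprime q-prime (p≢q ∘ sym ∘ prime∣prime⇒≡ q-prime p-prime)
*-primePowerView {p} p-prime (coprimeProduct {a} {b} 1<a 1<b a⊥b) with p ∣? a
... | yes p∣a = subst PrimePowerView (*-assoc p a b)
  (coprimeProduct (<-≤-trans 1<a (m≤n*m a p {{prime⇒nonZero p-prime}})) 1<b
    (coprime-*ˡ (∣-coprime p∣a a⊥b) a⊥b))
... | no p∤a  = subst PrimePowerView (sym (x∙yz≈y∙xz p a b))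
  (coprimeProduct 1<a (<-≤-trans 1<b (m≤n*m b p {{prime⇒nonZero p-prime}}))
    (Coprimality.sym (coprime-*ˡ (prime∤⇒coprime p-prime p∤a) (Coprimality.sym a⊥b))))

productPrimePowerView : ∀ {ps} → All Prime ps → PrimePowerView (product ps)
productPrimePowerView []                   = unit
productPrimePowerView (p-prime ∷ ps-prime) = *-primePowerView p-prime (productPrimePowerView ps-prime)

primePowerView : ∀ d .{{_ : NonZero d}} → PrimePowerView d
primePowerView d = subst PrimePowerView (sym isFactorisation) (productPrimePowerView factorsPrime)
  where open PrimeFactorisation (factorise d)

record Multiplicative (f : ℕ → ℕ) : Set where
  field
    1-homo : f 1 ≡ 1
    *-homo : ∀ {a b} → Coprime a b → f (a * b) ≡ f a * f b

module _ {f g : ℕ → ℕ} (f-mult : Multiplicative f) (g-mult : Multiplicative g) where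
  open Multiplicative

  least-excess-isPrimePower : ∀ {D} d → 0 < d → d ∣ D → g d < f d →
    (∀ d′ → 0 < d′ → d′ ∣ D → g d′ < f d′ → d ≤ d′) → IsPrimePower d
  least-excess-isPrimePower {D} d 0<d d∣D excess least with primePowerView d {{>-nonZero 0<d}}
  ... | unit = contradiction (trans (1-homo g-mult) (sym (1-homo f-mult))) (<⇒≢ excess)
  ... | primePower d-pp = d-pp
  ... | coprimeProduct {a} {b} 1<a 1<b a⊥b = contradiction excess (≤⇒≯ (begin
    f (a * b)   ≡⟨ *-homo f-mult a⊥b ⟩
    f a * f b   ≤⟨ *-mono-≤ (no-excess-below 0<a (m∣m*n b) a<ab) (no-excess-below 0<b (n∣m*n a) b<ab) ⟩
    g a * g b   ≡⟨ *-homo g-mult a⊥b ⟨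
    g (a * b)   ∎))
    where
    open ≤-Reasoning
    no-excess-below : ∀ {e} → 0 < e → e ∣ a * b → e < a * b → f e ≤ g e
    no-excess-below {e} 0<e e∣d e<d = ≮⇒≥ λ g<f → <⇒≱ e<d (least e 0<e (∣-trans e∣d d∣D) g<f)
    0<a : 0 < a
    0<a = <-trans z<s 1<a
    0<b : 0 < b
    0<b = <-trans z<s 1<b
    a<ab : a < a * b
    a<ab = m<m*n a b {{>-nonZero 0<a}} 1<b
    b<ab : b < a * b
    b<ab = subst (b <_) (*-comm b a) (m<m*n b a {{>-nonZero 0<b}} 1<a)

module _ {A : Set} where

  Unique-lookup-injective : ∀ {xs : List A} → Unique xs → ∀ i j → lookup xs i ≡ lookup xs j → i ≡ j
  Unique-lookup-injective (_ ∷ _)      zero    zero    _  = refl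
  Unique-lookup-injective (x∉xs ∷ _)   zero    (suc j) eq = contradiction eq (All.lookup x∉xs (∈-lookup j))
  Unique-lookup-injective (x∉xs ∷ _)   (suc i) zero    eq = contradiction (sym eq) (All.lookup x∉xs (∈-lookup i))
  Unique-lookup-injective (_ ∷ xs!)    (suc i) (suc j) eq = cong suc (Unique-lookup-injective xs! i j eq)

  length-≤-injection : ∀ {B : Set} {xs : List A} {ys : List B} (f : A → B) → Unique xs →
    (∀ {x} → x ∈ xs → f x ∈ ys) → (∀ {x y} → x ∈ xs → y ∈ xs → f x ≡ f y → x ≡ y) →
    length xs ≤ length ys
  length-≤-injection {B} f xs! into inj = injective⇒≤ {f = λ i → index (into (∈-lookup i))} λ {i} {j} eq →
    Unique-lookup-injective xs! i j
      (inj (∈-lookup i) (∈-lookup j) (index-injective (setoid B) (into (∈-lookup i)) (into (∈-lookup j)) eq))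

  length-cartesianProduct : ∀ {B : Set} (xs : List A) (ys : List B) →
    length (cartesianProduct xs ys) ≡ length xs * length ys
  length-cartesianProduct []       ys = refl
  length-cartesianProduct (x ∷ xs) ys = trans (length-++ (map (x ,_) ys))
    (cong₂ _+_ (length-map (x ,_) ys) (length-cartesianProduct xs ys))

module FinAbGroupProperties {n : ℕ} (G : FinAbGroup n) where
  open FinAbGroup G

  abelianGroup : AbelianGroup 0ℓ 0ℓ
  abelianGroup = record { isAbelianGroup = isAbelianGroup }

  open AbelianGroup abelianGroup using (identityˡ; identityʳ; comm; commutativeMonoid; group)
  open import Algebra.Properties.Group group using (∙-cancelʳ)
  open import Algebra.Properties.CommutativeMonoid.Mult commutativeMonoid
    using (×-homo-+; ×-assocˡ; ×-distrib-+) renaming (_×_ to _×ᴳ_)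
  open ≡-Reasoning

  pow≡× : ∀ g k → pow G g k ≡ k ×ᴳ g
  pow≡× g zero    = refl
  pow≡× g (suc k) = cong (g ∙_) (pow≡× g k)

  pow-+ : ∀ g i j → pow G g (i + j) ≡ pow G g i ∙ pow G g j
  pow-+ g i j rewrite pow≡× g (i + j) | pow≡× g i | pow≡× g j = ×-homo-+ g i j

  pow-* : ∀ g i j → pow G (pow G g j) i ≡ pow G g (i * j)
  pow-* g i j rewrite pow≡× (pow G g j) i | pow≡× g j | pow≡× g (i * j) = ×-assocˡ g i j

  pow-∙ : ∀ g h k → pow G (g ∙ h) k ≡ pow G g k ∙ pow G h k
  pow-∙ g h k rewrite pow≡× (g ∙ h) k | pow≡× g k | pow≡× h k = ×-distrib-+ g h k

  pow-ε : ∀ k → pow G ε k ≡ ε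
  pow-ε zero    = refl
  pow-ε (suc k) = trans (identityˡ (pow G ε k)) (pow-ε k)

  pow-1 : ∀ g → pow G g 1 ≡ g
  pow-1 = identityʳ

  pow-∙-absorbˡ : ∀ g h k → pow G g k ≡ ε → pow G (g ∙ h) k ≡ pow G h k
  pow-∙-absorbˡ g h k gᵏ≡ε = trans (pow-∙ g h k) (trans (cong (_∙ pow G h k) gᵏ≡ε) (identityˡ _))

  pow-∙-absorbʳ : ∀ g h k → pow G h k ≡ ε → pow G (g ∙ h) k ≡ pow G g k
  pow-∙-absorbʳ g h k hᵏ≡ε = trans (cong (λ x → pow G x k) (comm g h)) (pow-∙-absorbˡ h g k hᵏ≡ε)

  ∣⇒pow≡ε : ∀ g {d k} → pow G g d ≡ ε → d ∣ k → pow G g k ≡ ε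
  ∣⇒pow≡ε g {d} gᵈ≡ε (divides q refl) =
    trans (sym (pow-* g q d)) (trans (cong (λ x → pow G x q) gᵈ≡ε) (pow-ε q))

  -- If s a = 1 + t b then g = (gᵃ)ˢ ((gᵇ)ᵗ)⁻¹ is determined by gᵃ and gᵇ.
  Bézout-pow-injective : ∀ g h {a b} s t → 1 + t * b ≡ s * a →
    pow G g a ≡ pow G h a → pow G g b ≡ pow G h b → g ≡ h
  Bézout-pow-injective g h {a} {b} s t eq gᵃ≡hᵃ gᵇ≡hᵇ = ∙-cancelʳ (pow G (pow G g b) t) g h (begin
    g ∙ pow G (pow G g b) t   ≡⟨ expand g ⟨
    pow G (pow G g a) s       ≡⟨ cong (λ x → pow G x s) gᵃ≡hᵃ ⟩
    pow G (pow G h a) s       ≡⟨ expand h ⟩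
    h ∙ pow G (pow G h b) t   ≡⟨ cong (λ x → h ∙ pow G x t) gᵇ≡hᵇ ⟨
    h ∙ pow G (pow G g b) t   ∎)
    where
    expand : ∀ x → pow G (pow G x a) s ≡ x ∙ pow G (pow G x b) t
    expand x = begin
      pow G (pow G x a) s         ≡⟨ pow-* x s a ⟩
      pow G x (s * a)             ≡⟨ cong (pow G x) eq ⟨
      pow G x (1 + t * b)         ≡⟨ pow-+ x 1 (t * b) ⟩
      pow G x 1 ∙ pow G x (t * b) ≡⟨ cong₂ _∙_ (pow-1 x) (sym (pow-* x t b)) ⟩
      x ∙ pow G (pow G x b) t     ∎

  coprime-pow-injective : ∀ g h {a b} → Coprime a b →
    pow G g a ≡ pow G h a → pow G g b ≡ pow G h b → g ≡ h
  coprime-pow-injective g h {a} {b} a⊥b gᵃ≡hᵃ gᵇ≡hᵇ with coprime-Bézout a⊥b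
  ... | Bézout.+- s t eq = Bézout-pow-injective g h {a} {b} s t eq gᵃ≡hᵃ gᵇ≡hᵇ
  ... | Bézout.-+ t s eq = Bézout-pow-injective g h {b} {a} s t eq gᵇ≡hᵇ gᵃ≡hᵃ

  coprime-∙-injective : ∀ x y x′ y′ {a b} → Coprime a b →
    pow G x a ≡ ε → pow G x′ a ≡ ε → pow G y b ≡ ε → pow G y′ b ≡ ε →
    x ∙ y ≡ x′ ∙ y′ → x ≡ x′ × y ≡ y′
  coprime-∙-injective x y x′ y′ {a} {b} a⊥b xᵃ≡ε x′ᵃ≡ε yᵇ≡ε y′ᵇ≡ε xy≡x′y′ =
    coprime-pow-injective x x′ a⊥b (trans xᵃ≡ε (sym x′ᵃ≡ε)) xᵇ≡x′ᵇ ,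
    coprime-pow-injective y y′ a⊥b yᵃ≡y′ᵃ (trans yᵇ≡ε (sym y′ᵇ≡ε))
    where
    xᵇ≡x′ᵇ : pow G x b ≡ pow G x′ b
    xᵇ≡x′ᵇ = begin
      pow G x b          ≡⟨ pow-∙-absorbʳ x y b yᵇ≡ε ⟨
      pow G (x ∙ y) b    ≡⟨ cong (λ z → pow G z b) xy≡x′y′ ⟩
      pow G (x′ ∙ y′) b  ≡⟨ pow-∙-absorbʳ x′ y′ b y′ᵇ≡ε ⟩
      pow G x′ b         ∎
    yᵃ≡y′ᵃ : pow G y a ≡ pow G y′ a
    yᵃ≡y′ᵃ = begin
      pow G y a          ≡⟨ pow-∙-absorbˡ x y a xᵃ≡ε ⟨
      pow G (x ∙ y) a    ≡⟨ cong (λ z → pow G z a) xy≡x′y′ ⟩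
      pow G (x′ ∙ y′) a  ≡⟨ pow-∙-absorbˡ x′ y′ a x′ᵃ≡ε ⟩
      pow G y′ a         ∎

  pow-order : ∀ g {d} → HasOrder G g d → pow G g d ≡ ε
  pow-order g (_ , gᵈ≡ε , _) = gᵈ≡ε

  pow≡ε∧<order⇒≡0 : ∀ g {d r} → HasOrder G g d → r < d → pow G g r ≡ ε → r ≡ 0
  pow≡ε∧<order⇒≡0 g {r = zero}  _                 _   _    = refl
  pow≡ε∧<order⇒≡0 g {r = suc r} (_ , _ , minimal) r<d gʳ≡ε = contradiction
    (subst (λ i → pow G g i ≡ ε) (sym (toℕ-fromℕ< r<d)) gʳ≡ε)
    (minimal (fromℕ< r<d) (subst (0 <_) (sym (toℕ-fromℕ< r<d)) z<s))

  order-∣ : ∀ g {d k} → HasOrder G g d → pow G g k ≡ ε → d ∣ k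
  order-∣ g {d} {k} g-ord@(0<d , gᵈ≡ε , _) gᵏ≡ε =
    m%n≡0⇒n∣m k d (pow≡ε∧<order⇒≡0 g g-ord (m%n<n k d) gʳ≡ε)
    where
    instance
      d≢0 : NonZero d
      d≢0 = >-nonZero 0<d
    gʳ≡ε : pow G g (k % d) ≡ ε
    gʳ≡ε = begin
      pow G g (k % d)                       ≡⟨ identityʳ _ ⟨
      pow G g (k % d) ∙ ε                   ≡⟨ cong (pow G g (k % d) ∙_) gᑫᵈ≡ε ⟨
      pow G g (k % d) ∙ pow G g (k / d * d) ≡⟨ pow-+ g (k % d) (k / d * d) ⟨
      pow G g (k % d + k / d * d)           ≡⟨ cong (pow G g) (m≡m%n+[m/n]*n k d) ⟨
      pow G g k                             ≡⟨ gᵏ≡ε ⟩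
      ε                                     ∎
      where
      gᑫᵈ≡ε : pow G g (k / d * d) ≡ ε
      gᑫᵈ≡ε = ∣⇒pow≡ε g gᵈ≡ε (n∣m*n (k / d))

  hasOrder : ∀ g {d} → 0 < d → pow G g d ≡ ε → (∀ k → pow G g k ≡ ε → d ∣ k) → HasOrder G g d
  hasOrder g 0<d gᵈ≡ε least = 0<d , gᵈ≡ε , λ i 0<i gⁱ≡ε →
    <⇒≱ (toℕ<n i) (∣⇒≤ {{>-nonZero 0<i}} (least (toℕ i) gⁱ≡ε))

  pow-hasOrder : ∀ g {a b} → HasOrder G g (a * b) → HasOrder G (pow G g b) a
  pow-hasOrder g {a} {b} g-ord@(0<ab , gᵃᵇ≡ε , _) =
    hasOrder (pow G g b) (>-nonZero⁻¹ a) (trans (pow-* g a b) gᵃᵇ≡ε) λ k gᵇᵏ≡ε →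
      *-cancelʳ-∣ b (order-∣ g g-ord (trans (sym (pow-* g k b)) gᵇᵏ≡ε))
    where
    instance
      ab≢0 : NonZero (a * b)
      ab≢0 = >-nonZero 0<ab
      a≢0 : NonZero a
      a≢0 = m*n≢0⇒m≢0 a
      b≢0 : NonZero b
      b≢0 = m*n≢0⇒n≢0 a

  ∙-hasOrder : ∀ x y {a b} → Coprime a b →
    HasOrder G x a → HasOrder G y b → HasOrder G (x ∙ y) (a * b)
  ∙-hasOrder x y {a} {b} a⊥b x-ord@(0<a , xᵃ≡ε , _) y-ord@(0<b , yᵇ≡ε , _) =
    hasOrder (x ∙ y) (*-mono-< 0<a 0<b) xyᵃᵇ≡ε λ k xyᵏ≡ε → coprime⇒*∣ a⊥b
      (coprime-divisor a⊥b (order-∣ x x-ord (xᵇᵏ≡ε k xyᵏ≡ε)))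
      (coprime-divisor (Coprimality.sym a⊥b) (order-∣ y y-ord (yᵃᵏ≡ε k xyᵏ≡ε)))
    where
    xyᵃᵇ≡ε : pow G (x ∙ y) (a * b) ≡ ε
    xyᵃᵇ≡ε = trans (pow-∙-absorbˡ x y (a * b) (∣⇒pow≡ε x xᵃ≡ε (m∣m*n {a} b)))
                   (∣⇒pow≡ε y yᵇ≡ε (n∣m*n a))
    xᵇᵏ≡ε : ∀ k → pow G (x ∙ y) k ≡ ε → pow G x (b * k) ≡ ε
    xᵇᵏ≡ε k xyᵏ≡ε = trans (sym (pow-∙-absorbʳ x y (b * k) (∣⇒pow≡ε y yᵇ≡ε (m∣m*n {b} k))))
                          (∣⇒pow≡ε (x ∙ y) xyᵏ≡ε (n∣m*n b))
    yᵃᵏ≡ε : ∀ k → pow G (x ∙ y) k ≡ ε → pow G y (a * k) ≡ ε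
    yᵃᵏ≡ε k xyᵏ≡ε = trans (sym (pow-∙-absorbˡ x y (a * k) (∣⇒pow≡ε x xᵃ≡ε (m∣m*n {a} k))))
                          (∣⇒pow≡ε (x ∙ y) xyᵏ≡ε (n∣m*n a))

  ε-hasOrder-1 : HasOrder G ε 1
  ε-hasOrder-1 = hasOrder ε z<s (pow-1 ε) (λ k _ → 1∣ k)

  hasOrder-1⇒≡ε : ∀ g → HasOrder G g 1 → g ≡ ε
  hasOrder-1⇒≡ε g g-ord = trans (sym (pow-1 g)) (pow-order g g-ord)

  ofOrder : ℕ → List (Fin n)
  ofOrder d = filter (hasOrder? G d) (allFin n)

  ofOrder-unique : ∀ d → Unique (ofOrder d)
  ofOrder-unique d = filter⁺ (hasOrder? G d) {allFin n} (allFin⁺ n)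

  ∈-ofOrder⁺ : ∀ {g d} → HasOrder G g d → g ∈ ofOrder d
  ∈-ofOrder⁺ {g} {d} g-ord = ∈-filter⁺ (hasOrder? G d) (∈-allFin g) g-ord

  ∈-ofOrder⁻ : ∀ {g d} → g ∈ ofOrder d → HasOrder G g d
  ∈-ofOrder⁻ {d = d} g∈ = proj₂ (∈-filter⁻ (hasOrder? G d) {xs = allFin n} g∈)

  φ[1]≡1 : φ G 1 ≡ 1
  φ[1]≡1 = ≤-antisym
    (length-≤-injection {ys = ε ∷ []} id (ofOrder-unique 1)
      (λ g∈ → here (hasOrder-1⇒≡ε _ (∈-ofOrder⁻ g∈))) λ _ _ → id)
    (length-≤-injection {xs = ε ∷ []} id ([] ∷ [])
      (λ { (here refl) → ∈-ofOrder⁺ ε-hasOrder-1 }) λ _ _ → id)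

  φ-*-≤ : ∀ {a b} → Coprime a b → φ G (a * b) ≤ φ G a * φ G b
  φ-*-≤ {a} {b} a⊥b = subst (φ G (a * b) ≤_) (length-cartesianProduct (ofOrder a) (ofOrder b))
    (length-≤-injection (λ g → pow G g b , pow G g a) (ofOrder-unique (a * b)) into
      λ {g} {h} _ _ eq → coprime-pow-injective g h a⊥b (cong proj₂ eq) (cong proj₁ eq))
    where
    into : ∀ {g} → g ∈ ofOrder (a * b) →
      (pow G g b , pow G g a) ∈ cartesianProduct (ofOrder a) (ofOrder b)
    into {g} g∈ = ∈-cartesianProduct⁺
      (∈-ofOrder⁺ (pow-hasOrder g (∈-ofOrder⁻ g∈)))
      (∈-ofOrder⁺ (pow-hasOrder g (subst (HasOrder G g) (*-comm a b) (∈-ofOrder⁻ g∈))))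

  φ-*-≥ : ∀ {a b} → Coprime a b → φ G a * φ G b ≤ φ G (a * b)
  φ-*-≥ {a} {b} a⊥b = subst (_≤ φ G (a * b)) (length-cartesianProduct (ofOrder a) (ofOrder b))
    (length-≤-injection (uncurry _∙_) (cartesianProduct⁺ (ofOrder-unique a) (ofOrder-unique b)) into inj)
    where
    pairs : List (Fin n × Fin n)
    pairs = cartesianProduct (ofOrder a) (ofOrder b)
    orders : ∀ {x y} → (x , y) ∈ pairs → HasOrder G x a × HasOrder G y b
    orders xy∈ = Product.map ∈-ofOrder⁻ ∈-ofOrder⁻ (∈-cartesianProduct⁻ (ofOrder a) (ofOrder b) xy∈)
    into : ∀ {xy} → xy ∈ pairs → uncurry _∙_ xy ∈ ofOrder (a * b)
    into {x , y} xy∈ = ∈-ofOrder⁺ (uncurry (∙-hasOrder x y a⊥b) (orders xy∈))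
    inj : ∀ {xy xy′} → xy ∈ pairs → xy′ ∈ pairs → uncurry _∙_ xy ≡ uncurry _∙_ xy′ → xy ≡ xy′
    inj {x , y} {x′ , y′} xy∈ x′y′∈ eq
      with (x-ord , y-ord) ← orders xy∈ | (x′-ord , y′-ord) ← orders x′y′∈ =
      uncurry (cong₂ _,_) (coprime-∙-injective x y x′ y′ a⊥b
        (pow-order x x-ord) (pow-order x′ x′-ord) (pow-order y y-ord) (pow-order y′ y′-ord) eq)

  φ-multiplicative : Multiplicative (φ G)
  φ-multiplicative = record
    { 1-homo = φ[1]≡1
    ; *-homo = λ a⊥b → ≤-antisym (φ-*-≤ a⊥b) (φ-*-≥ a⊥b)
    }

lemma2p3 : ∀ {n m : ℕ} (G : FinAbGroup n) (H : FinAbGroup m) →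
    (∀ d → 0 < d → d ∣ gcd n m → φ H d < φ G d →
      (∀ d′ → 0 < d′ → d′ ∣ gcd n m → φ H d′ < φ G d′ → d ≤ d′) →
      IsPrimePower d)
    ×
    (∀ d → 0 < d → d ∣ gcd n m → φ G d < φ H d →
      (∀ d′ → 0 < d′ → d′ ∣ gcd n m → φ G d′ < φ H d′ → d ≤ d′) →
      IsPrimePower d)
lemma2p3 G H =
  least-excess-isPrimePower (φ-multiplicative G) (φ-multiplicative H) ,
  least-excess-isPrimePower (φ-multiplicative H) (φ-multiplicative G)
  where open FinAbGroupProperties using (φ-multiplicative)
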